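{- Let $1 \le m \le n$, let $d$ be a positive integer, let $w_1,\dots,w_m \in GF(2)^n$ be linearly independent, and let $G=(V,E)$ be the associated lexigraph. Then the Sprague–Grundy function $g$ of $G$ satisfies $g(u_1 \oplus u_2) = g(u_1) \oplus g(u_2)$ for all $u_1, u_2 \in V$.
   Context: For $k \in \{0,\dots,2^m-1\}$ with binary digits $k^h$, set $A_k = \sum_{h=0}^{m-1} k^h w_{h+1} \in GF(2)^n$. The lexigraph is the digraph $G=(V,E)$ with $V = \{A_0,\dots,A_{2^m-1}\}$ (the span of $w_1,\dots,w_m$) and $(A_k,A_j) \in E$ iff $j<k$ and the Hamming weight of $A_j \oplus A_k$ is less than $d$; it is finite and acyclic. With $F(u)=\{v:(u,v)\in E\}$, the Sprague–Grundy function is the unique $g: V \to \mathbb{Z}_{\ge 0}$ with $g(u) = \operatorname{mex}\{g(v): v \in F(u)\}$, where $\operatorname{mex}(S)$ is the least nonnegative integer not in $S$. On vectors $\oplus$ is addition in $GF(2)^n$; on integers $\oplus$ is the nim-sum (bitwise XOR). -}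

module Defs where

open import Data.Bool using (Bool; true; false; _xor_; if_then_else_)
open import Data.Nat using (ℕ; zero; suc; _+_; _*_; _<_; _≤_)
open import Data.Nat.DivMod using (_/_; _%_)
open import Data.Vec using (Vec; []; _∷_; replicate; zipWith; count)
open import Data.Product using (Σ; ∃; _×_; _,_)
open import Relation.Nullary using (¬_)
open import Relation.Binary.PropositionalEquality using (_≡_)
open import Relation.Nullary.Decidable using (does)
open import Data.Bool.Properties using (T?)

-- GF(2)^n as Vec Bool n; addition is componentwise xor
_⊕_ : ∀ {n} → Vec Bool n → Vec Bool n → Vec Bool n
_⊕_ = zipWith _xor_

0ᵥ : ∀ {n} → Vec Bool n
0ᵥ = replicate _ false

weight : ∀ {n} → Vec Bool n → ℕ
weight = count (λ b → T? b)

-- linear combination Σ_h c_h w_{h+1} (c, w indexed from h = 0)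
comb : ∀ {m n} → Vec (Vec Bool n) m → Vec Bool m → Vec Bool n
comb []       []       = 0ᵥ
comb (w ∷ ws) (b ∷ c) = if b then w ⊕ comb ws c else comb ws c

LinIndep : ∀ {m n} → Vec (Vec Bool n) m → Set
LinIndep {m} ws = ∀ (c : Vec Bool m) → comb ws c ≡ 0ᵥ → c ≡ replicate m false

-- the integer k whose binary digits (least significant first) are c
bitVal : Bool → ℕ
bitVal true  = 1
bitVal false = 0

toℕ : ∀ {m} → Vec Bool m → ℕ
toℕ []      = 0
toℕ (b ∷ c) = bitVal b + 2 * toℕ c

-- A_k for the index k whose binary digit vector is c
A : ∀ {m n} → Vec (Vec Bool n) m → Vec Bool m → Vec Bool n
A = comb

InV : ∀ {m n} → Vec (Vec Bool n) m → Vec Bool n → Set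
InV {m} ws u = ∃ λ (k : Vec Bool m) → u ≡ A ws k

Edge : ∀ {m n} → Vec (Vec Bool n) m → ℕ → Vec Bool n → Vec Bool n → Set
Edge {m} ws d u v = Σ (Vec Bool m) λ k → Σ (Vec Bool m) λ j →
  (u ≡ A ws k) × (v ≡ A ws j) × (toℕ j < toℕ k) × (weight (A ws j ⊕ A ws k) < d)

IsMex : (ℕ → Set) → ℕ → Set
IsMex S x = ¬ S x × (∀ y → y < x → S y)

IsSG : ∀ {m n} → Vec (Vec Bool n) m → ℕ → (Vec Bool n → ℕ) → Set
IsSG ws d g = ∀ u → InV ws u →
  IsMex (λ y → ∃ λ v → Edge ws d u v × g v ≡ y) (g u)

-- nim-sum (bitwise xor) on ℕ, by recursion on fuel
nimAux : ℕ → ℕ → ℕ → ℕ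
nimAux zero    a b = 0
nimAux (suc f) a b = bitVal (does (a % 2 Data.Nat.≟ b % 2) xor true)
                     + 2 * nimAux f (a / 2) (b / 2)

-- fuel a + b suffices: a, b halve at each step
_⊕ℕ_ : ℕ → ℕ → ℕ
a ⊕ℕ b = nimAux (a + b) a b

{-# OPTIONS --safe #-}
-- Since the w's are independent, k ↦ A_k is an injective GF(2)-linear map, so the lexigraph
-- is the game on GF(2)^m in which k may move to any j below k in binary order with j ⊕ k in
-- a fixed set C.  Positions under ⊕ and Grundy values under the nim-sum share one property:
-- every v below a ⊕ b is a' ⊕ b with a' below a, or a ⊕ b' with b' below b (split at the
-- highest bit where v and a ⊕ b differ).  Induct on the sum of the binary values of a and b.
-- If g (a ⊕ b) < g a ⊕ g b, split that value and realise the part below g a by a move a → a';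
-- then a' ⊕ b and a ⊕ b are a move apart with equal Grundy values.  If g (a ⊕ b) > g a ⊕ g b,
-- split the position reached by the move realising g a ⊕ g b; it is a' ⊕ b for a move
-- a → a', and cancelling g b gives g a' = g a.
module Submission where

open import Defs
open import Algebra.Bundles using (CommutativeSemigroup)
import Algebra.Properties.CommutativeSemigroup as CommutativeSemigroupProperties
open import Data.Bool using (Bool; true; false; _xor_)
open import Data.Bool.Properties
  using (xor-assoc; xor-comm; xor-identityˡ; xor-identityʳ; xor-same)
open import Data.Nat using (ℕ; zero; suc; _+_; _*_; _^_; _<_; _≤_; _≮_; z≤n; s≤s; _≟_)
open import Data.Nat.Properties
open import Data.Nat.DivMod using (_/_; _%_; m≡m%n+[m/n]*n; m%n<n; m/n*n≤m; m<n*o⇒m/o<n)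
open import Data.Nat.Induction using (<-wellFounded)
open import Data.Vec using (Vec; []; _∷_)
open import Data.Vec.Properties
  using (zipWith-assoc; zipWith-comm; zipWith-identityˡ; zipWith-identityʳ)
open import Data.Empty using (⊥)
open import Data.Product using (_×_; _,_; proj₁; proj₂; ∃-syntax)
open import Data.Sum using (_⊎_; inj₁; inj₂; [_,_]′)
import Data.Sum as Sum
open import Function using (_∘_)
open import Induction.WellFounded using (module All)
open import Level using (0ℓ)
import Relation.Binary.Construct.On as On
open import Relation.Binary.Definitions using (tri<; tri≈; tri>)
open import Relation.Binary.PropositionalEquality
open import Relation.Binary.PropositionalEquality.Algebra using (isMagma)
open import Relation.Nullary using (does; contradiction)

⊕-assoc : ∀ {n} (x y z : Vec Bool n) → (x ⊕ y) ⊕ z ≡ x ⊕ (y ⊕ z)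
⊕-assoc = zipWith-assoc xor-assoc

⊕-comm : ∀ {n} (x y : Vec Bool n) → x ⊕ y ≡ y ⊕ x
⊕-comm = zipWith-comm xor-comm

⊕-identityˡ : ∀ {n} (x : Vec Bool n) → 0ᵥ ⊕ x ≡ x
⊕-identityˡ = zipWith-identityˡ xor-identityˡ

⊕-identityʳ : ∀ {n} (x : Vec Bool n) → x ⊕ 0ᵥ ≡ x
⊕-identityʳ = zipWith-identityʳ xor-identityʳ

⊕-self : ∀ {n} (x : Vec Bool n) → x ⊕ x ≡ 0ᵥ
⊕-self []      = refl
⊕-self (b ∷ x) = cong₂ _∷_ (xor-same b) (⊕-self x)

⊕-commutativeSemigroup : ℕ → CommutativeSemigroup 0ℓ 0ℓ
⊕-commutativeSemigroup n = record
  { Carrier                = Vec Bool n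
  ; _≈_                    = _≡_
  ; _∙_                    = _⊕_
  ; isCommutativeSemigroup = record
    { isSemigroup = record { isMagma = isMagma _⊕_ ; assoc = ⊕-assoc }
    ; comm        = ⊕-comm
    }
  }

module ⊕-Properties {n : ℕ} = CommutativeSemigroupProperties (⊕-commutativeSemigroup n)

x⊕[x⊕y]≡y : ∀ {n} (x y : Vec Bool n) → x ⊕ (x ⊕ y) ≡ y
x⊕[x⊕y]≡y x y = begin
  x ⊕ (x ⊕ y) ≡⟨ ⊕-assoc x x y ⟨
  (x ⊕ x) ⊕ y ≡⟨ cong (_⊕ y) (⊕-self x) ⟩
  0ᵥ ⊕ y      ≡⟨ ⊕-identityˡ y ⟩
  y           ∎
  where open ≡-Reasoning

[x⊕y]⊕y≡x : ∀ {n} (x y : Vec Bool n) → (x ⊕ y) ⊕ y ≡ x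
[x⊕y]⊕y≡x x y = begin
  (x ⊕ y) ⊕ y ≡⟨ ⊕-assoc x y y ⟩
  x ⊕ (y ⊕ y) ≡⟨ cong (x ⊕_) (⊕-self y) ⟩
  x ⊕ 0ᵥ      ≡⟨ ⊕-identityʳ x ⟩
  x           ∎
  where open ≡-Reasoning

[x⊕z]⊕[y⊕z]≡x⊕y : ∀ {n} (x y z : Vec Bool n) → (x ⊕ z) ⊕ (y ⊕ z) ≡ x ⊕ y
[x⊕z]⊕[y⊕z]≡x⊕y x y z = begin
  (x ⊕ z) ⊕ (y ⊕ z) ≡⟨ ⊕-Properties.interchange x z y z ⟩
  (x ⊕ y) ⊕ (z ⊕ z) ≡⟨ cong ((x ⊕ y) ⊕_) (⊕-self z) ⟩
  (x ⊕ y) ⊕ 0ᵥ      ≡⟨ ⊕-identityʳ (x ⊕ y) ⟩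
  x ⊕ y             ∎
  where open ≡-Reasoning

⊕-cancelʳ : ∀ {n} {x y : Vec Bool n} (z : Vec Bool n) → x ⊕ z ≡ y ⊕ z → x ≡ y
⊕-cancelʳ {x = x} {y} z e = begin
  x           ≡⟨ [x⊕y]⊕y≡x x z ⟨
  (x ⊕ z) ⊕ z ≡⟨ cong (_⊕ z) e ⟩
  (y ⊕ z) ⊕ z ≡⟨ [x⊕y]⊕y≡x y z ⟩
  y           ∎
  where open ≡-Reasoning

bitVal≤1 : ∀ b → bitVal b ≤ 1
bitVal≤1 true  = s≤s z≤n
bitVal≤1 false = z≤n

bitVal-injective : ∀ {b c} → bitVal b ≡ bitVal c → b ≡ c
bitVal-injective {true}  {true}  _ = refl
bitVal-injective {false} {false} _ = refl

bitVal-< : ∀ {b c} → bitVal b < bitVal c → b ≡ false × c ≡ true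
bitVal-< {false} {true}  _       = refl , refl
bitVal-< {true}  {true}  (s≤s ())
bitVal-< {_}     {false} ()

m<n⇒bitVal+2m<2n : ∀ {m n} b → m < n → bitVal b + 2 * m < 2 * n
m<n⇒bitVal+2m<2n {m} {n} b m<n = begin-strict
  bitVal b + 2 * m ≤⟨ +-monoˡ-≤ (2 * m) (bitVal≤1 b) ⟩
  1 + 2 * m        <⟨ n<1+n _ ⟩
  2 + 2 * m        ≡⟨ *-suc 2 m ⟨
  2 * suc m        ≤⟨ *-monoʳ-≤ 2 m<n ⟩
  2 * n            ∎
  where open ≤-Reasoning

∷-<-tail : ∀ {n} b c (p q : Vec Bool n) → toℕ p < toℕ q → toℕ (b ∷ p) < toℕ (c ∷ q)
∷-<-tail b c p q p<q =
  <-≤-trans (m<n⇒bitVal+2m<2n b p<q) (m≤n+m (2 * toℕ q) (bitVal c))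

∷-<-head : ∀ {n} (p : Vec Bool n) → toℕ (false ∷ p) < toℕ (true ∷ p)
∷-<-head p = n<1+n (2 * toℕ p)

toℕ-injective : ∀ {n} (p q : Vec Bool n) → toℕ p ≡ toℕ q → p ≡ q
toℕ-injective []      []      _ = refl
toℕ-injective (b ∷ p) (c ∷ q) e with <-cmp (toℕ p) (toℕ q)
... | tri< p<q _ _ = contradiction e (<⇒≢ (∷-<-tail b c p q p<q))
... | tri> _ _ p>q = contradiction (sym e) (<⇒≢ (∷-<-tail c b q p p>q))
... | tri≈ _ p≡q _ with refl ← toℕ-injective p q p≡q =
  cong (_∷ q) (bitVal-injective (+-cancelʳ-≡ (2 * toℕ q) (bitVal b) (bitVal c) e))

∷-<-inv : ∀ {n} {b c} {p q : Vec Bool n} → toℕ (b ∷ p) < toℕ (c ∷ q) →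
          toℕ p < toℕ q ⊎ (p ≡ q × b ≡ false × c ≡ true)
∷-<-inv {b = b} {c} {p} {q} lt with <-cmp (toℕ p) (toℕ q)
... | tri< p<q _ _ = inj₁ p<q
... | tri> _ _ p>q = contradiction lt (<-asym (∷-<-tail c b q p p>q))
... | tri≈ _ p≡q _ with refl ← toℕ-injective p q p≡q =
  inj₂ (refl , bitVal-< (+-cancelʳ-< (2 * toℕ q) (bitVal b) (bitVal c) lt))

⊕-split-lex : ∀ {n} (v a b : Vec Bool n) → toℕ v < toℕ (a ⊕ b) →
              toℕ (v ⊕ b) < toℕ a ⊎ toℕ (a ⊕ v) < toℕ b
⊕-split-lex []       []       []       ()
⊕-split-lex (v₀ ∷ v) (a₀ ∷ a) (b₀ ∷ b) lt with ∷-<-inv {b = v₀} {a₀ xor b₀} {v} {a ⊕ b} lt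
... | inj₁ v<a⊕b = Sum.map (∷-<-tail (v₀ xor b₀) a₀ (v ⊕ b) a) (∷-<-tail (a₀ xor v₀) b₀ (a ⊕ v) b)
                           (⊕-split-lex v a b v<a⊕b)
... | inj₂ (refl , refl , a₀⊕b₀≡1)
  rewrite [x⊕y]⊕y≡x a b | x⊕[x⊕y]≡y a b = top-bit a₀ b₀ a₀⊕b₀≡1
  where
  top-bit : ∀ a₀ b₀ → a₀ xor b₀ ≡ true →
            toℕ (b₀ ∷ a) < toℕ (a₀ ∷ a) ⊎ toℕ ((a₀ xor false) ∷ b) < toℕ (b₀ ∷ b)
  top-bit true  false _ = inj₁ (∷-<-head a)
  top-bit false true  _ = inj₂ (∷-<-head b)

⊕-split : ∀ {n} {v a b : Vec Bool n} → toℕ v < toℕ (a ⊕ b) →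
          (∃[ a' ] toℕ a' < toℕ a × a' ⊕ b ≡ v) ⊎ (∃[ b' ] toℕ b' < toℕ b × a ⊕ b' ≡ v)
⊕-split {v = v} {a} {b} lt =
  Sum.map (λ lt → v ⊕ b , lt , [x⊕y]⊕y≡x v b) (λ lt → a ⊕ v , lt , x⊕[x⊕y]≡y a v)
          (⊕-split-lex v a b lt)

toBit : ℕ → Bool
toBit zero    = false
toBit (suc _) = true

bitVal-toBit : ∀ {r} → r < 2 → bitVal (toBit r) ≡ r
bitVal-toBit {0} _ = refl
bitVal-toBit {1} _ = refl
bitVal-toBit {suc (suc _)} (s≤s (s≤s ()))

bits : (K : ℕ) → ℕ → Vec Bool K
bits zero    _ = []
bits (suc K) a = toBit (a % 2) ∷ bits K (a / 2)

toℕ-bits : ∀ K {a} → a < 2 ^ K → toℕ (bits K a) ≡ a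
toℕ-bits zero    {zero}  _       = refl
toℕ-bits zero    {suc _} (s≤s ())
toℕ-bits (suc K) {a}    a<2^[1+K] = begin
  bitVal (toBit (a % 2)) + 2 * toℕ (bits K (a / 2))
    ≡⟨ cong₂ (λ r q → r + 2 * q) (bitVal-toBit (m%n<n a 2)) (toℕ-bits K a/2<2^K) ⟩
  a % 2 + 2 * (a / 2)
    ≡⟨ cong (a % 2 +_) (*-comm 2 (a / 2)) ⟩
  a % 2 + a / 2 * 2
    ≡⟨ m≡m%n+[m/n]*n a 2 ⟨
  a ∎
  where
  open ≡-Reasoning
  a/2<2^K : a / 2 < 2 ^ K
  a/2<2^K = m<n*o⇒m/o<n (subst (a <_) (*-comm 2 (2 ^ K)) a<2^[1+K])

toℕ<2^ : ∀ {K} (v : Vec Bool K) → toℕ v < 2 ^ K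
toℕ<2^ []      = s≤s z≤n
toℕ<2^ (b ∷ v) = m<n⇒bitVal+2m<2n b (toℕ<2^ v)

n<2^n : ∀ n → n < 2 ^ n
n<2^n zero    = s≤s z≤n
n<2^n (suc n) = begin-strict
  suc n           ≤⟨ n<2^n n ⟩
  2 ^ n           <⟨ m<m+n (2 ^ n) (m^n>0 2 n) ⟩
  2 ^ n + 2 ^ n   ≡⟨ cong (2 ^ n +_) (+-identityʳ (2 ^ n)) ⟨
  2 * 2 ^ n       ∎
  where open ≤-Reasoning

toℕ-bits-≤ : ∀ {K a} → a ≤ K → toℕ (bits K a) ≡ a
toℕ-bits-≤ {K} a≤K = toℕ-bits K (≤-<-trans a≤K (n<2^n K))

bits-toℕ : ∀ {K} (v : Vec Bool K) → bits K (toℕ v) ≡ v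
bits-toℕ {K} v = toℕ-injective (bits K (toℕ v)) v (toℕ-bits K (toℕ<2^ v))

xor-toBit : ∀ {r s} → r < 2 → s < 2 → does (r ≟ s) xor true ≡ toBit r xor toBit s
xor-toBit {0} {0} _ _ = refl
xor-toBit {0} {1} _ _ = refl
xor-toBit {1} {0} _ _ = refl
xor-toBit {1} {1} _ _ = refl
xor-toBit {suc (suc _)} (s≤s (s≤s ())) _
xor-toBit {_} {suc (suc _)} _ (s≤s (s≤s ()))

nimAux-bits : ∀ f a b → nimAux f a b ≡ toℕ (bits f a ⊕ bits f b)
nimAux-bits zero    a b = refl
nimAux-bits (suc f) a b = cong₂ (λ r q → bitVal r + 2 * q)
  (xor-toBit (m%n<n a 2) (m%n<n b 2)) (nimAux-bits f (a / 2) (b / 2))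

m*2≤1+n⇒m≤n : ∀ {m n} → m * 2 ≤ suc n → m ≤ n
m*2≤1+n⇒m≤n {zero}  _       = z≤n
m*2≤1+n⇒m≤n {suc m} (s≤s h) = ≤-trans (s≤s (m≤m*n m 2)) h

halve-sum : ∀ a b {f} → a + b ≤ suc f → a / 2 + b / 2 ≤ f
halve-sum a b {f} h = m*2≤1+n⇒m≤n (begin
  (a / 2 + b / 2) * 2    ≡⟨ *-distribʳ-+ 2 (a / 2) (b / 2) ⟩
  a / 2 * 2 + b / 2 * 2  ≤⟨ +-mono-≤ (m/n*n≤m a 2) (m/n*n≤m b 2) ⟩
  a + b                  ≤⟨ h ⟩
  suc f                  ∎)
  where open ≤-Reasoning

nimAux-0 : ∀ a b → a + b ≤ 0 → ∀ f → nimAux f a b ≡ 0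
nimAux-0 zero zero _ zero    = refl
nimAux-0 zero zero _ (suc f) = cong (2 *_) (nimAux-0 0 0 z≤n f)

nimAux-fuel : ∀ a b {f f'} → a + b ≤ f → a + b ≤ f' → nimAux f a b ≡ nimAux f' a b
nimAux-fuel a b {zero}  {f'}     h _  = trans (nimAux-0 a b h 0) (sym (nimAux-0 a b h f'))
nimAux-fuel a b {f}     {zero}   _ h' = trans (nimAux-0 a b h' f) (sym (nimAux-0 a b h' 0))
nimAux-fuel a b {suc f} {suc f'} h h' =
  cong (λ q → bitVal (does (a % 2 ≟ b % 2) xor true) + 2 * q)
       (nimAux-fuel (a / 2) (b / 2) (halve-sum a b h) (halve-sum a b h'))

⊕ℕ-bits : ∀ {K} a b → a + b ≤ K → a ⊕ℕ b ≡ toℕ (bits K a ⊕ bits K b)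
⊕ℕ-bits {K} a b h = trans (nimAux-fuel a b ≤-refl h) (nimAux-bits K a b)

toℕ-⊕ : ∀ {K} (u w : Vec Bool K) → toℕ u + toℕ w ≤ K → toℕ u ⊕ℕ toℕ w ≡ toℕ (u ⊕ w)
toℕ-⊕ u w h =
  trans (⊕ℕ-bits (toℕ u) (toℕ w) h) (cong₂ (λ x y → toℕ (x ⊕ y)) (bits-toℕ u) (bits-toℕ w))

⊕ℕ-comm : ∀ a b → a ⊕ℕ b ≡ b ⊕ℕ a
⊕ℕ-comm a b = begin
  a ⊕ℕ b                    ≡⟨ ⊕ℕ-bits a b ≤-refl ⟩
  toℕ (bits K a ⊕ bits K b) ≡⟨ cong toℕ (⊕-comm (bits K a) (bits K b)) ⟩
  toℕ (bits K b ⊕ bits K a) ≡⟨ ⊕ℕ-bits b a (≤-reflexive (+-comm b a)) ⟨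
  b ⊕ℕ a                    ∎
  where
  open ≡-Reasoning
  K = a + b

⊕ℕ-cancelʳ : ∀ {a b} c → a ⊕ℕ c ≡ b ⊕ℕ c → a ≡ b
⊕ℕ-cancelʳ {a} {b} c e = begin
  a              ≡⟨ toℕ-bits-≤ (≤-trans (m≤m+n a c) a+c≤K) ⟨
  toℕ (bits K a) ≡⟨ cong toℕ (⊕-cancelʳ (bits K c) sums-equal) ⟩
  toℕ (bits K b) ≡⟨ toℕ-bits-≤ (≤-trans (m≤m+n b c) b+c≤K) ⟩
  b              ∎
  where
  open ≡-Reasoning
  K = a + b + c
  a+c≤K : a + c ≤ K
  a+c≤K = +-monoˡ-≤ c (m≤m+n a b)
  b+c≤K : b + c ≤ K
  b+c≤K = +-monoˡ-≤ c (m≤n+m b a)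
  sums-equal : bits K a ⊕ bits K c ≡ bits K b ⊕ bits K c
  sums-equal = toℕ-injective _ _ (begin
    toℕ (bits K a ⊕ bits K c) ≡⟨ ⊕ℕ-bits a c a+c≤K ⟨
    a ⊕ℕ c                    ≡⟨ e ⟩
    b ⊕ℕ c                    ≡⟨ ⊕ℕ-bits b c b+c≤K ⟩
    toℕ (bits K b ⊕ bits K c) ∎)

⊕ℕ-split : ∀ {v a b} → v < a ⊕ℕ b →
           (∃[ x ] x < a × x ⊕ℕ b ≡ v) ⊎ (∃[ y ] y < b × a ⊕ℕ y ≡ v)
⊕ℕ-split {v} {a} {b} v<a⊕b =
  Sum.map left right (⊕-split (subst₂ _<_ (sym bv≡v) a⊕b≡ v<a⊕b))
  where
  open ≡-Reasoning
  K = a + b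
  ba = bits K a
  bb = bits K b
  a⊕b≡ : a ⊕ℕ b ≡ toℕ (ba ⊕ bb)
  a⊕b≡ = ⊕ℕ-bits a b ≤-refl
  ba≡a : toℕ ba ≡ a
  ba≡a = toℕ-bits-≤ (m≤m+n a b)
  bb≡b : toℕ bb ≡ b
  bb≡b = toℕ-bits-≤ (m≤n+m b a)
  bv≡v : toℕ (bits K v) ≡ v
  bv≡v = toℕ-bits K (<-trans (subst (v <_) a⊕b≡ v<a⊕b) (toℕ<2^ (ba ⊕ bb)))
  left : ∃[ a' ] toℕ a' < toℕ ba × a' ⊕ bb ≡ bits K v → ∃[ x ] x < a × x ⊕ℕ b ≡ v
  left (a' , a'<ba , e) = toℕ a' , a'<a , (begin
    toℕ a' ⊕ℕ b      ≡⟨ cong (toℕ a' ⊕ℕ_) bb≡b ⟨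
    toℕ a' ⊕ℕ toℕ bb ≡⟨ toℕ-⊕ a' bb (+-mono-≤ (<⇒≤ a'<a) (≤-reflexive bb≡b)) ⟩
    toℕ (a' ⊕ bb)    ≡⟨ cong toℕ e ⟩
    toℕ (bits K v)   ≡⟨ bv≡v ⟩
    v                ∎)
    where
    a'<a : toℕ a' < a
    a'<a = subst (toℕ a' <_) ba≡a a'<ba
  right : ∃[ b' ] toℕ b' < toℕ bb × ba ⊕ b' ≡ bits K v → ∃[ y ] y < b × a ⊕ℕ y ≡ v
  right (b' , b'<bb , e) = toℕ b' , b'<b , (begin
    a ⊕ℕ toℕ b'      ≡⟨ cong (_⊕ℕ toℕ b') ba≡a ⟨
    toℕ ba ⊕ℕ toℕ b' ≡⟨ toℕ-⊕ ba b' (+-mono-≤ (≤-reflexive ba≡a) (<⇒≤ b'<b)) ⟩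
    toℕ (ba ⊕ b')    ≡⟨ cong toℕ e ⟩
    toℕ (bits K v)   ≡⟨ bv≡v ⟩
    v                ∎)
    where
    b'<b : toℕ b' < b
    b'<b = subst (toℕ b' <_) bb≡b b'<bb

IsGrundy : ∀ {m} → (Vec Bool m → Set) → (Vec Bool m → ℕ) → Set
IsGrundy C G = ∀ k → IsMex (λ y → ∃[ j ] toℕ j < toℕ k × C (j ⊕ k) × G j ≡ y) (G k)

module _ {m} (C : Vec Bool m → Set) {G : Vec Bool m → ℕ} (grundy : IsGrundy C G) where

  private
    move-changes-G : ∀ {j k} → toℕ j < toℕ k → C (j ⊕ k) → G j ≢ G k
    move-changes-G {j} {k} j<k c Gj≡Gk = proj₁ (grundy k) (j , j<k , c , Gj≡Gk)

    smaller-G-reachable : ∀ {k y} → y < G k → ∃[ j ] toℕ j < toℕ k × C (j ⊕ k) × G j ≡ y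
    smaller-G-reachable {k} {y} = proj₂ (grundy k) y

    adjacent-changes-G : ∀ {p q} → C (p ⊕ q) → p ≢ q → G p ≢ G q
    adjacent-changes-G {p} {q} c p≢q with <-cmp (toℕ p) (toℕ q)
    ... | tri< p<q _ _ = move-changes-G p<q c
    ... | tri≈ _ e _   = contradiction (toℕ-injective p q e) p≢q
    ... | tri> _ _ p>q = move-changes-G p>q (subst C (⊕-comm p q) c) ∘ sym

    LinearBelow : Vec Bool m → Vec Bool m → Set
    LinearBelow a b = ∀ a' → toℕ a' < toℕ a → G (a' ⊕ b) ≡ G a' ⊕ℕ G b

    below-impossible : ∀ {a b x} → LinearBelow a b → x < G a → x ⊕ℕ G b ≢ G (a ⊕ b)
    below-impossible {a} {b} linear x<Ga e with smaller-G-reachable x<Ga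
    ... | a' , a'<a , c , refl =
      adjacent-changes-G (subst C (sym ([x⊕z]⊕[y⊕z]≡x⊕y a' a b)) c)
        (λ a'⊕b≡a⊕b → <⇒≢ a'<a (cong toℕ (⊕-cancelʳ b a'⊕b≡a⊕b)))
        (trans (linear a' a'<a) e)

    above-impossible : ∀ {a b a'} → LinearBelow a b → toℕ a' < toℕ a →
                       C ((a' ⊕ b) ⊕ (a ⊕ b)) → G (a' ⊕ b) ≢ G a ⊕ℕ G b
    above-impossible {a} {b} {a'} linear a'<a c e =
      move-changes-G a'<a (subst C ([x⊕z]⊕[y⊕z]≡x⊕y a' a b) c)
        (⊕ℕ-cancelʳ (G b) (trans (sym (linear a' a'<a)) e))

    not-below : ∀ {a b} → LinearBelow a b → LinearBelow b a → G (a ⊕ b) ≮ G a ⊕ℕ G b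
    not-below {a} {b} linear linear' lt = [ from-a , from-b ]′ (⊕ℕ-split lt)
      where
      from-a : ∃[ x ] x < G a × x ⊕ℕ G b ≡ G (a ⊕ b) → ⊥
      from-a (x , x<Ga , e) = below-impossible linear x<Ga e
      from-b : ∃[ y ] y < G b × G a ⊕ℕ y ≡ G (a ⊕ b) → ⊥
      from-b (y , y<Gb , e) = below-impossible linear' y<Gb
        (trans (⊕ℕ-comm y (G a)) (trans e (cong G (⊕-comm a b))))

    not-above : ∀ {a b} → LinearBelow a b → LinearBelow b a → G a ⊕ℕ G b ≮ G (a ⊕ b)
    not-above {a} {b} linear linear' gt with smaller-G-reachable gt
    ... | j , j<a⊕b , c , e = [ from-a , from-b ]′ (⊕-split j<a⊕b)
      where
      from-a : ∃[ a' ] toℕ a' < toℕ a × a' ⊕ b ≡ j → ⊥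
      from-a (a' , a'<a , refl) = above-impossible linear a'<a c e
      from-b : ∃[ b' ] toℕ b' < toℕ b × a ⊕ b' ≡ j → ⊥
      from-b (b' , b'<b , refl) = above-impossible linear' b'<b
        (subst C (cong₂ _⊕_ (⊕-comm a b') (⊕-comm a b)) c)
        (trans (cong G (⊕-comm b' a)) (trans e (⊕ℕ-comm (G a) (G b))))

  grundy-linear : ∀ a b → G (a ⊕ b) ≡ G a ⊕ℕ G b
  grundy-linear a b = All.wfRec (On.wellFounded size <-wellFounded) 0ℓ Linear step (a , b)
    where
    size : Vec Bool m × Vec Bool m → ℕ
    size (a , b) = toℕ a + toℕ b
    Linear : Vec Bool m × Vec Bool m → Set
    Linear (a , b) = G (a ⊕ b) ≡ G a ⊕ℕ G b
    step : ∀ ab → (∀ {ab'} → size ab' < size ab → Linear ab') → Linear ab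
    step (a , b) rec =
      ≤-antisym (≮⇒≥ (not-above linear linear')) (≮⇒≥ (not-below linear linear'))
      where
      linear : LinearBelow a b
      linear a' a'<a = rec {a' , b} (+-monoˡ-< (toℕ b) a'<a)
      linear' : LinearBelow b a
      linear' b' b'<b = rec {b' , a}
        (subst (toℕ b' + toℕ a <_) (+-comm (toℕ b) (toℕ a)) (+-monoˡ-< (toℕ a) b'<b))

comb-⊕ : ∀ {m n} (ws : Vec (Vec Bool n) m) (j k : Vec Bool m) →
         comb ws (j ⊕ k) ≡ comb ws j ⊕ comb ws k
comb-⊕ []       []          []          = sym (⊕-identityʳ 0ᵥ)
comb-⊕ (w ∷ ws) (false ∷ j) (false ∷ k) = comb-⊕ ws j k
comb-⊕ (w ∷ ws) (true ∷ j)  (false ∷ k) =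
  trans (cong (w ⊕_) (comb-⊕ ws j k)) (sym (⊕-assoc w (comb ws j) (comb ws k)))
comb-⊕ (w ∷ ws) (false ∷ j) (true ∷ k)  =
  trans (cong (w ⊕_) (comb-⊕ ws j k)) (⊕-Properties.x∙yz≈y∙xz w (comb ws j) (comb ws k))
comb-⊕ (w ∷ ws) (true ∷ j)  (true ∷ k)  = begin
  comb ws (j ⊕ k)                   ≡⟨ comb-⊕ ws j k ⟩
  comb ws j ⊕ comb ws k             ≡⟨ ⊕-identityˡ _ ⟨
  0ᵥ ⊕ (comb ws j ⊕ comb ws k)      ≡⟨ cong (_⊕ (comb ws j ⊕ comb ws k)) (⊕-self w) ⟨
  (w ⊕ w) ⊕ (comb ws j ⊕ comb ws k) ≡⟨ ⊕-Properties.interchange w (comb ws j) w (comb ws k) ⟨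
  (w ⊕ comb ws j) ⊕ (w ⊕ comb ws k) ∎
  where open ≡-Reasoning

comb-injective : ∀ {m n} (ws : Vec (Vec Bool n) m) → LinIndep ws →
                 ∀ {j k} → comb ws j ≡ comb ws k → j ≡ k
comb-injective ws independent {j} {k} e =
  ⊕-cancelʳ k (trans (independent (j ⊕ k) comb[j⊕k]≡0) (sym (⊕-self k)))
  where
  open ≡-Reasoning
  comb[j⊕k]≡0 : comb ws (j ⊕ k) ≡ 0ᵥ
  comb[j⊕k]≡0 = begin
    comb ws (j ⊕ k)       ≡⟨ comb-⊕ ws j k ⟩
    comb ws j ⊕ comb ws k ≡⟨ cong (_⊕ comb ws k) e ⟩
    comb ws k ⊕ comb ws k ≡⟨ ⊕-self (comb ws k) ⟩
    0ᵥ                    ∎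

IsMex-resp : ∀ {S T : ℕ → Set} {x} → (∀ {y} → S y → T y) → (∀ {y} → T y → S y) →
             IsMex S x → IsMex T x
IsMex-resp S⊆T T⊆S (x∉S , below-x∈S) = x∉S ∘ T⊆S , λ y y<x → S⊆T (below-x∈S y y<x)

WithinDistance : ∀ {m n} → Vec (Vec Bool n) m → ℕ → Vec Bool m → Set
WithinDistance ws d x = weight (A ws x) < d

lexigraph-isGrundy : ∀ {m n} d (ws : Vec (Vec Bool n) m) {g} → LinIndep ws → IsSG ws d g →
                     IsGrundy (WithinDistance ws d) (g ∘ A ws)
lexigraph-isGrundy d ws {g} independent sg k =
  IsMex-resp edge⇒move move⇒edge (sg (A ws k) (k , refl))
  where
  weight-⊕ : ∀ j → weight (A ws (j ⊕ k)) ≡ weight (A ws j ⊕ A ws k)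
  weight-⊕ j = cong weight (comb-⊕ ws j k)
  edge⇒move : ∀ {y} → ∃[ v ] Edge ws d (A ws k) v × g v ≡ y →
              ∃[ j ] toℕ j < toℕ k × WithinDistance ws d (j ⊕ k) × g (A ws j) ≡ y
  edge⇒move (_ , (k' , j , Ak≡Ak' , refl , j<k' , light) , gv≡y)
    with refl ← comb-injective ws independent {k} {k'} Ak≡Ak' =
    j , j<k' , subst (_< d) (sym (weight-⊕ j)) light , gv≡y
  move⇒edge : ∀ {y} → ∃[ j ] toℕ j < toℕ k × WithinDistance ws d (j ⊕ k) × g (A ws j) ≡ y →
              ∃[ v ] Edge ws d (A ws k) v × g v ≡ y
  move⇒edge (j , j<k , light , gAj≡y) =
    A ws j , (k , j , refl , refl , j<k , subst (_< d) (weight-⊕ j) light) , gAj≡y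

theorem1 : (m n d : ℕ) → 1 ≤ m → m ≤ n → 1 ≤ d →
    (ws : Vec (Vec Bool n) m) → LinIndep ws →
    (g : Vec Bool n → ℕ) → IsSG ws d g →
    ∀ u₁ u₂ → InV ws u₁ → InV ws u₂ →
    g (u₁ ⊕ u₂) ≡ (g u₁ ⊕ℕ g u₂)
theorem1 _ _ d _ _ _ ws independent g sg _ _ (k₁ , refl) (k₂ , refl) = begin
  g (A ws k₁ ⊕ A ws k₂)      ≡⟨ cong g (comb-⊕ ws k₁ k₂) ⟨
  g (A ws (k₁ ⊕ k₂))         ≡⟨ grundy-linear (WithinDistance ws d) lexigraph-grundy k₁ k₂ ⟩
  g (A ws k₁) ⊕ℕ g (A ws k₂) ∎
  where
  open ≡-Reasoning
  lexigraph-grundy : IsGrundy (WithinDistance ws d) (g ∘ A ws)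
  lexigraph-grundy = lexigraph-isGrundy d ws independent sg
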